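{- Let $J=J(12,4)_{\{1,3\}}$. For any permutation $\phi$ of $\{1,\dots,12\}$, if an automorphism $\Psi$ of $J$ fixes every vertex in $S=\{V^{\phi}_j, V^{\phi\tau_1}_j, V^{\phi\tau_2}_j : j=1,\dots,12\}$, then $\Psi$ also fixes $V^{\phi\tau_i}_j$ for all $i,j\in\{1,\dots,12\}$.
   Context: $J(12,4)_{\{1,3\}}$ is the graph whose vertices are the 4-element subsets of $\{1,\dots,12\}$, with $M,N$ adjacent iff $|M\cap N|\in\{3,1\}$. For a permutation $\phi$ of $\{1,\dots,12\}$ and $\ell\in\{1,\dots,12\}$, $V^\phi_\ell=\{\phi(\ell),\phi(\ell+1),\phi(\ell+2),\phi(\ell+3)\}$, indices taken modulo 12. For $i=1,\dots,12$, $\tau_i$ is the transposition exchanging $i$ and $i+1$ (modulo 12). Products are compositions: $(\phi\tau)(x)=\phi(\tau(x))$. -}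

module Defs where

open import Data.Nat using (ℕ; _+_)
open import Data.Nat.DivMod using (_mod_)
open import Data.Fin using (Fin; toℕ)
open import Data.Fin.Subset using (Subset; ⁅_⁆; _∪_; _∩_; ∣_∣)
open import Data.Fin.Permutation using (Permutation′; _⟨$⟩ʳ_; transpose)
open import Data.Product using (Σ; proj₁)
open import Data.Sum using (_⊎_)
open import Relation.Binary.PropositionalEquality using (_≡_)
open import Function.Bundles using (_⇔_)

-- Ground set {1,...,12} is represented by Fin 12, element k+1 ↦ k.

_⊕_ : Fin 12 → ℕ → Fin 12
ℓ ⊕ k = (toℕ ℓ + k) mod 12

Vertex : Set
Vertex = Σ (Subset 12) (λ M → ∣ M ∣ ≡ 4)

Adj : Vertex → Vertex → Set
Adj M N = ∣ proj₁ M ∩ proj₁ N ∣ ≡ 3 ⊎ ∣ proj₁ M ∩ proj₁ N ∣ ≡ 1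

_≈V_ : Vertex → Vertex → Set
M ≈V N = proj₁ M ≡ proj₁ N

record Automorphism : Set where
  field
    to        : Vertex → Vertex
    from      : Vertex → Vertex
    inverseˡ  : ∀ v → to (from v) ≈V v
    inverseʳ  : ∀ v → from (to v) ≈V v
    preserves : ∀ u v → Adj u v ⇔ Adj (to u) (to v)

open Automorphism public

Fixes : Automorphism → Subset 12 → Set
Fixes Ψ M = ∀ (v : Vertex) → proj₁ v ≡ M → proj₁ (to Ψ v) ≡ M

V : (Fin 12 → Fin 12) → Fin 12 → Subset 12
V φ ℓ = ⁅ φ (ℓ ⊕ 0) ⁆ ∪ (⁅ φ (ℓ ⊕ 1) ⁆ ∪ (⁅ φ (ℓ ⊕ 2) ⁆ ∪ ⁅ φ (ℓ ⊕ 3) ⁆))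

-- τ_i exchanges i and i+1 (mod 12); τ (index k) is τ_{k+1}
τ : Fin 12 → Permutation′ 12
τ i = transpose i (i ⊕ 1)

_∘τ_ : Permutation′ 12 → Fin 12 → (Fin 12 → Fin 12)
(φ ∘τ i) x = φ ⟨$⟩ʳ (τ i ⟨$⟩ʳ x)

⟦_⟧ : Permutation′ 12 → (Fin 12 → Fin 12)
⟦ φ ⟧ x = φ ⟨$⟩ʳ x

-- Two 4-sets meet in at most four points, so adjacency in J(12,4)_{1,3} is odd intersection, and an
-- automorphism fixing a vertex F preserves the parity of |v ∩ F| for every vertex v. Reading subsets
-- as vectors over GF(2) and pulling back along φ, the 36 members of S become the windows
-- {σ(ℓ), …, σ(ℓ+3)} for σ ∈ {id, τ₁, τ₂}, and explicit combinations of these windows give every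
-- e₀ + e_k. Hence the parities of |v ∩ F|, F ∈ S, determine a 4-set v up to complement; the
-- complement has 8 elements, so Ψ fixes every vertex, in particular every V^{φτ_i}_j.
module Submission where

open import Algebra.Bundles using (CommutativeRing)
open import Data.Bool using (Bool; true; false; not; _∧_; _xor_)
import Data.Bool.Properties as Bool
open import Data.Bool.Properties
  using (xor-∧-commutativeRing; xor-same; xor-assoc; xor-identityʳ; ∧-distribˡ-xor; ∧-identityʳ; ∧-zeroʳ; ⇔→≡)
open import Algebra.Properties.CommutativeSemigroup
  (CommutativeRing.+-commutativeSemigroup xor-∧-commutativeRing) using (interchange)
open import Data.Fin using (Fin; zero; suc; #_)
open import Data.Fin.Permutation using (Permutation′; _⟨$⟩ʳ_; _⟨$⟩ˡ_)
import Data.Fin.Permutation as Permutation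
open import Data.Fin.Properties using (all?; _≟_)
open import Data.Fin.Subset using (Subset; ⁅_⁆; _∪_; _∩_; ∣_∣; ⊥; ∁; ⋃; _∉_; outside; inside)
open import Data.Fin.Subset.Properties
  using (∪-identityˡ; ∪-identityʳ; drop-not-there; ∣⊥∣≡0; ∉⊥; x∈p∪q⁻; x∈⁅y⁆⇒x≡y; ∣p∩q∣≤∣p∣; ∣∁p∣≡n∸∣p∣)
open import Data.List using (List; []; _∷_; foldr; map; length)
open import Data.List.Membership.Propositional using () renaming (_∉_ to _∉ₗ_)
import Data.List.Relation.Unary.Any as Any
open import Data.List.Relation.Unary.Unique.Propositional using (Unique; []; _∷_)
open import Data.List.Relation.Unary.Unique.Propositional.Properties using (map⁺; map⁻; Unique[x∷xs]⇒x∉xs)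
open import Data.List.Relation.Unary.Unique.DecPropositional (_≟_ {12}) using (unique?)
open import Data.Nat using (ℕ; zero; suc; _∸_; _≤_; s≤s)
open import Data.Product using (_×_; _,_; proj₁; proj₂; uncurry)
open import Data.Sum using (_⊎_; inj₁; inj₂)
open import Data.Vec using ([]; _∷_; here; lookup; zipWith; tabulate)
import Data.Vec as Vec
open import Data.Vec.Properties using (lookup∘tabulate; lookup-map; ≡-dec)
open import Data.Vec.Relation.Binary.Pointwise.Extensional using (ext; Pointwise-≡⇒≡)
open import Function using (id; _∘_)
open import Function.Bundles using (_⇔_; mk⇔; Injection)
import Function.Properties.Equivalence as ⇔
open import Function.Properties.Inverse using (↔⇒↣)
open import Relation.Binary.PropositionalEquality
  using (_≡_; _≢_; refl; sym; trans; cong; cong₂; subst; module ≡-Reasoning)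
open import Relation.Nullary using (contradiction)
open import Relation.Nullary.Decidable using (from-yes)

open import Defs

private variable
  m n : ℕ

odd : ℕ → Bool
odd zero    = false
odd (suc n) = not (odd n)

infixr 6 _△_
_△_ : Subset n → Subset n → Subset n
_△_ = zipWith _xor_

⨁ : List (Subset n) → Subset n
⨁ = foldr _△_ ⊥

infix 5.5 _·_
_·_ : Subset n → Subset n → Bool
[] · [] = false
(x ∷ p) · (y ∷ q) = (x ∧ y) xor p · q

odd-∣p∩q∣ : (p q : Subset n) → odd ∣ p ∩ q ∣ ≡ p · q
odd-∣p∩q∣ []          []          = refl
odd-∣p∩q∣ (true ∷ p)  (true ∷ q)  = cong not (odd-∣p∩q∣ p q)
odd-∣p∩q∣ (true ∷ p)  (false ∷ q) = odd-∣p∩q∣ p q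
odd-∣p∩q∣ (false ∷ p) (y ∷ q)     = odd-∣p∩q∣ p q

·-⊥ : (p : Subset n) → p · ⊥ ≡ false
·-⊥ []      = refl
·-⊥ (x ∷ p) rewrite ∧-zeroʳ x = ·-⊥ p

·-⁅⁆ : (p : Subset n) (i : Fin n) → p · ⁅ i ⁆ ≡ lookup p i
·-⁅⁆ (x ∷ p) zero    rewrite ∧-identityʳ x | ·-⊥ p = xor-identityʳ x
·-⁅⁆ (x ∷ p) (suc i) rewrite ∧-zeroʳ x = ·-⁅⁆ p i

·-△ : (p q r : Subset n) → p · q △ r ≡ p · q xor p · r
·-△ [] [] [] = refl
·-△ (x ∷ p) (y ∷ q) (z ∷ r) rewrite ∧-distribˡ-xor x y z | ·-△ p q r =
  interchange (x ∧ y) (x ∧ z) (p · q) (p · r)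

·-⁅⁆△⁅⁆ : (p : Subset n) (x y : Fin n) → p · ⁅ x ⁆ △ ⁅ y ⁆ ≡ lookup p x xor lookup p y
·-⁅⁆△⁅⁆ p x y = trans (·-△ p ⁅ x ⁆ ⁅ y ⁆) (cong₂ _xor_ (·-⁅⁆ p x) (·-⁅⁆ p y))

·-⨁-cong : {A : Set} (p q : Subset n) (f : A → Subset n) → (∀ a → p · f a ≡ q · f a) →
            ∀ as → p · ⨁ (map f as) ≡ q · ⨁ (map f as)
·-⨁-cong p q f agree []       = trans (·-⊥ p) (sym (·-⊥ q))
·-⨁-cong p q f agree (a ∷ as) = begin
  p · f a △ ⨁ (map f as)        ≡⟨ ·-△ p (f a) _ ⟩
  p · f a xor p · ⨁ (map f as)  ≡⟨ cong₂ _xor_ (agree a) (·-⨁-cong p q f agree as) ⟩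
  q · f a xor q · ⨁ (map f as)  ≡⟨ ·-△ q (f a) _ ⟨
  q · f a △ ⨁ (map f as)        ∎
  where open ≡-Reasoning

△-identityˡ : (p : Subset n) → ⊥ △ p ≡ p
△-identityˡ []      = refl
△-identityˡ (x ∷ p) = cong (x ∷_) (△-identityˡ p)

⁅x⁆∪p≡⁅x⁆△p : {x : Fin n} {p : Subset n} → x ∉ p → ⁅ x ⁆ ∪ p ≡ ⁅ x ⁆ △ p
⁅x⁆∪p≡⁅x⁆△p {x = zero}  {inside  ∷ p} x∉p = contradiction here x∉p
⁅x⁆∪p≡⁅x⁆△p {x = zero}  {outside ∷ p} x∉p =
  cong (inside ∷_) (trans (∪-identityˡ p) (sym (△-identityˡ p)))
⁅x⁆∪p≡⁅x⁆△p {x = suc x} {y ∷ p}       x∉p = cong (y ∷_) (⁅x⁆∪p≡⁅x⁆△p (drop-not-there x∉p))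

∣⁅x⁆∪p∣≡1+∣p∣ : {x : Fin n} {p : Subset n} → x ∉ p → ∣ ⁅ x ⁆ ∪ p ∣ ≡ suc ∣ p ∣
∣⁅x⁆∪p∣≡1+∣p∣ {x = zero}  {inside  ∷ p} x∉p = contradiction here x∉p
∣⁅x⁆∪p∣≡1+∣p∣ {x = zero}  {outside ∷ p} x∉p = cong (suc ∘ ∣_∣) (∪-identityˡ p)
∣⁅x⁆∪p∣≡1+∣p∣ {x = suc x} {inside  ∷ p} x∉p = cong suc (∣⁅x⁆∪p∣≡1+∣p∣ (drop-not-there x∉p))
∣⁅x⁆∪p∣≡1+∣p∣ {x = suc x} {outside ∷ p} x∉p = ∣⁅x⁆∪p∣≡1+∣p∣ (drop-not-there x∉p)

x∉l⇒x∉⋃⁅l⁆ : {x : Fin n} (l : List (Fin n)) → x ∉ₗ l → x ∉ ⋃ (map ⁅_⁆ l)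
x∉l⇒x∉⋃⁅l⁆ []      _   = ∉⊥
x∉l⇒x∉⋃⁅l⁆ (y ∷ l) x∉l x∈⋃l with x∈p∪q⁻ ⁅ y ⁆ (⋃ (map ⁅_⁆ l)) x∈⋃l
... | inj₁ x∈⁅y⁆ = x∉l (Any.here (x∈⁅y⁆⇒x≡y y x∈⁅y⁆))
... | inj₂ x∈⋃l  = x∉l⇒x∉⋃⁅l⁆ l (x∉l ∘ Any.there) x∈⋃l

⋃⁅⁆≡⨁⁅⁆ : {l : List (Fin n)} → Unique l → ⋃ (map ⁅_⁆ l) ≡ ⨁ (map ⁅_⁆ l)
⋃⁅⁆≡⨁⁅⁆ []                  = refl
⋃⁅⁆≡⨁⁅⁆ {l = x ∷ l} u@(_ ∷ ul) = begin
  ⁅ x ⁆ ∪ ⋃ (map ⁅_⁆ l)  ≡⟨ ⁅x⁆∪p≡⁅x⁆△p (x∉l⇒x∉⋃⁅l⁆ l (Unique[x∷xs]⇒x∉xs u)) ⟩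
  ⁅ x ⁆ △ ⋃ (map ⁅_⁆ l)  ≡⟨ cong (⁅ x ⁆ △_) (⋃⁅⁆≡⨁⁅⁆ ul) ⟩
  ⁅ x ⁆ △ ⨁ (map ⁅_⁆ l)  ∎
  where open ≡-Reasoning

∣⋃⁅⁆∣≡length : {l : List (Fin n)} → Unique l → ∣ ⋃ (map ⁅_⁆ l) ∣ ≡ length l
∣⋃⁅⁆∣≡length {n} []                 = ∣⊥∣≡0 n
∣⋃⁅⁆∣≡length {l = x ∷ l} u@(_ ∷ ul) =
  trans (∣⁅x⁆∪p∣≡1+∣p∣ (x∉l⇒x∉⋃⁅l⁆ l (Unique[x∷xs]⇒x∉xs u))) (cong suc (∣⋃⁅⁆∣≡length ul))

preimage : (Fin m → Fin n) → Subset n → Subset m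
preimage f p = tabulate (lookup p ∘ f)

preimage-∁ : (f : Fin m → Fin n) (p : Subset n) → preimage f (∁ p) ≡ ∁ (preimage f p)
preimage-∁ f p = Pointwise-≡⇒≡ (ext λ x → begin
  lookup (preimage f (∁ p)) x   ≡⟨ lookup∘tabulate _ x ⟩
  lookup (∁ p) (f x)            ≡⟨ lookup-map (f x) not p ⟩
  not (lookup p (f x))          ≡⟨ cong not (lookup∘tabulate _ x) ⟨
  not (lookup (preimage f p) x) ≡⟨ lookup-map x not (preimage f p) ⟨
  lookup (∁ (preimage f p)) x   ∎)
  where open ≡-Reasoning

preimage-injective : (π : Permutation′ n) {p q : Subset n} →
                     preimage (π ⟨$⟩ʳ_) p ≡ preimage (π ⟨$⟩ʳ_) q → p ≡ q
preimage-injective π {p} {q} eq = Pointwise-≡⇒≡ (ext λ x → begin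
  lookup p x                                  ≡⟨ cong (lookup p) (Permutation.inverseʳ π) ⟨
  lookup p (π ⟨$⟩ʳ (π ⟨$⟩ˡ x))                ≡⟨ lookup∘tabulate _ (π ⟨$⟩ˡ x) ⟨
  lookup (preimage (π ⟨$⟩ʳ_) p) (π ⟨$⟩ˡ x)    ≡⟨ cong (λ r → lookup r (π ⟨$⟩ˡ x)) eq ⟩
  lookup (preimage (π ⟨$⟩ʳ_) q) (π ⟨$⟩ˡ x)    ≡⟨ lookup∘tabulate _ (π ⟨$⟩ˡ x) ⟩
  lookup q (π ⟨$⟩ʳ (π ⟨$⟩ˡ x))                ≡⟨ cong (lookup q) (Permutation.inverseʳ π) ⟩
  lookup q x                                  ∎)
  where open ≡-Reasoning

·-⨁⁅⁆-map : (f : Fin m → Fin n) (p : Subset n) (l : List (Fin m)) →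
             p · ⨁ (map ⁅_⁆ (map f l)) ≡ preimage f p · ⨁ (map ⁅_⁆ l)
·-⨁⁅⁆-map f p []      = trans (·-⊥ p) (sym (·-⊥ (preimage f p)))
·-⨁⁅⁆-map f p (x ∷ l) = begin
  p · ⁅ f x ⁆ △ ⨁ (map ⁅_⁆ (map f l))
    ≡⟨ ·-△ p ⁅ f x ⁆ _ ⟩
  p · ⁅ f x ⁆ xor p · ⨁ (map ⁅_⁆ (map f l))
    ≡⟨ cong₂ _xor_ (·-⁅⁆ p (f x)) (·-⨁⁅⁆-map f p l) ⟩
  lookup p (f x) xor p′ · ⨁ (map ⁅_⁆ l)
    ≡⟨ cong (_xor _) (sym (trans (·-⁅⁆ p′ x) (lookup∘tabulate (lookup p ∘ f) x))) ⟩
  p′ · ⁅ x ⁆ xor p′ · ⨁ (map ⁅_⁆ l)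
    ≡⟨ ·-△ p′ ⁅ x ⁆ _ ⟨
  p′ · ⁅ x ⁆ △ ⨁ (map ⁅_⁆ l) ∎
  where
  open ≡-Reasoning
  p′ = preimage f p

·-⋃⁅⁆-map : (f : Fin m → Fin n) (p : Subset n) {l : List (Fin m)} → Unique (map f l) →
             p · ⋃ (map ⁅_⁆ (map f l)) ≡ preimage f p · ⋃ (map ⁅_⁆ l)
·-⋃⁅⁆-map f p {l} u = begin
  p · ⋃ (map ⁅_⁆ (map f l))     ≡⟨ cong (p ·_) (⋃⁅⁆≡⨁⁅⁆ u) ⟩
  p · ⨁ (map ⁅_⁆ (map f l))     ≡⟨ ·-⨁⁅⁆-map f p l ⟩
  preimage f p · ⨁ (map ⁅_⁆ l)  ≡⟨ cong (preimage f p ·_) (⋃⁅⁆≡⨁⁅⁆ (map⁻ u)) ⟨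
  preimage f p · ⋃ (map ⁅_⁆ l)  ∎
  where open ≡-Reasoning

xor-transpose : ∀ a b c d → a xor b ≡ c xor d → b ≡ (a xor c) xor d
xor-transpose a b c d h = begin
  b                ≡⟨ cong (_xor b) (xor-same a) ⟨
  (a xor a) xor b  ≡⟨ xor-assoc a a b ⟩
  a xor (a xor b)  ≡⟨ cong (a xor_) h ⟩
  a xor (c xor d)  ≡⟨ xor-assoc a c d ⟨
  (a xor c) xor d  ∎
  where open ≡-Reasoning

xor-differences⇒≡⊎≡∁ : (p q : Subset n) (z : Fin n) →
                       (∀ x → lookup p z xor lookup p x ≡ lookup q z xor lookup q x) →
                       p ≡ q ⊎ p ≡ ∁ q
xor-differences⇒≡⊎≡∁ p q z diff with lookup p z xor lookup q z in shift
... | false = inj₁ (Pointwise-≡⇒≡ (ext λ x →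
  trans (xor-transpose (lookup p z) (lookup p x) (lookup q z) (lookup q x) (diff x)) (cong (_xor lookup q x) shift)))
... | true  = inj₂ (Pointwise-≡⇒≡ (ext λ x →
  trans (xor-transpose (lookup p z) (lookup p x) (lookup q z) (lookup q x) (diff x))
        (trans (cong (_xor lookup q x) shift) (sym (lookup-map x not q)))))

3⊎1⇔odd : ∀ {k} → k ≤ 4 → (k ≡ 3 ⊎ k ≡ 1) ⇔ (odd k ≡ true)
3⊎1⇔odd {0} _ = mk⇔ (λ { (inj₁ ()) ; (inj₂ ()) }) (λ ())
3⊎1⇔odd {1} _ = mk⇔ (λ _ → refl) (λ _ → inj₂ refl)
3⊎1⇔odd {2} _ = mk⇔ (λ { (inj₁ ()) ; (inj₂ ()) }) (λ ())
3⊎1⇔odd {3} _ = mk⇔ (λ _ → refl) (λ _ → inj₁ refl)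
3⊎1⇔odd {4} _ = mk⇔ (λ { (inj₁ ()) ; (inj₂ ()) }) (λ ())
3⊎1⇔odd {suc (suc (suc (suc (suc _))))} (s≤s (s≤s (s≤s (s≤s ()))))

Adj⇔odd-∣∩∣ : (u v : Vertex) → Adj u v ⇔ (odd ∣ proj₁ u ∩ proj₁ v ∣ ≡ true)
Adj⇔odd-∣∩∣ (u , ∣u∣≡4) (v , _) = 3⊎1⇔odd (subst (∣ u ∩ v ∣ ≤_) ∣u∣≡4 (∣p∩q∣≤∣p∣ u v))

odd-∣∩∣-invariant : (Ψ : Automorphism) (u F : Vertex) → Fixes Ψ (proj₁ F) →
                    odd ∣ proj₁ (to Ψ u) ∩ proj₁ F ∣ ≡ odd ∣ proj₁ u ∩ proj₁ F ∣
odd-∣∩∣-invariant Ψ u F fixF =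
  ⇔→≡ (⇔.trans (⇔.sym image-side) (⇔.trans (⇔.sym (preserves Ψ u F)) (Adj⇔odd-∣∩∣ u F)))
  where
  image-side : Adj (to Ψ u) (to Ψ F) ⇔ (odd ∣ proj₁ (to Ψ u) ∩ proj₁ F ∣ ≡ true)
  image-side = subst (λ X → Adj (to Ψ u) (to Ψ F) ⇔ (odd ∣ proj₁ (to Ψ u) ∩ X ∣ ≡ true))
                     (fixF F refl) (Adj⇔odd-∣∩∣ (to Ψ u) (to Ψ F))

vertex≢∁vertex : (u v : Vertex) → proj₁ u ≢ ∁ (proj₁ v)
vertex≢∁vertex (u , ∣u∣≡4) (v , ∣v∣≡4) u≡∁v = contradiction 4≡8 λ ()
  where
  open ≡-Reasoning
  4≡8 : 4 ≡ 8
  4≡8 = begin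
    4           ≡⟨ ∣u∣≡4 ⟨
    ∣ u ∣       ≡⟨ cong ∣_∣ u≡∁v ⟩
    ∣ ∁ v ∣     ≡⟨ ∣∁p∣≡n∸∣p∣ v ⟩
    12 ∸ ∣ v ∣  ≡⟨ cong (12 ∸_) ∣v∣≡4 ⟩
    8           ∎

window : (Fin 12 → Fin 12) → Fin 12 → List (Fin 12)
window h ℓ = h (ℓ ⊕ 0) ∷ h (ℓ ⊕ 1) ∷ h (ℓ ⊕ 2) ∷ h (ℓ ⊕ 3) ∷ []

V≡⋃⁅window⁆ : ∀ h ℓ → V h ℓ ≡ ⋃ (map ⁅_⁆ (window h ℓ))
V≡⋃⁅window⁆ h ℓ = cong (λ X → ⁅ h (ℓ ⊕ 0) ⁆ ∪ (⁅ h (ℓ ⊕ 1) ⁆ ∪ (⁅ h (ℓ ⊕ 2) ⁆ ∪ X)))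
                     (sym (∪-identityʳ ⁅ h (ℓ ⊕ 3) ⁆))

σ : Fin 3 → Fin 12 → Fin 12
σ zero             = id
σ (suc zero)       = τ zero ⟨$⟩ʳ_
σ (suc (suc zero)) = τ (suc zero) ⟨$⟩ʳ_

window-unique : ∀ s ℓ → Unique (window (σ s) ℓ)
window-unique = from-yes (all? λ s → all? λ ℓ → unique? (window (σ s) ℓ))

S : Permutation′ 12 → Fin 3 → Fin 12 → Subset 12
S φ s = V (⟦ φ ⟧ ∘ σ s)

S-unique : ∀ φ s ℓ → Unique (window (⟦ φ ⟧ ∘ σ s) ℓ)
S-unique φ s ℓ = map⁺ (Injection.injective (↔⇒↣ φ)) (window-unique s ℓ)

S-vertex : Permutation′ 12 → Fin 3 → Fin 12 → Vertex
S-vertex φ s ℓ = S φ s ℓ , trans (cong ∣_∣ (V≡⋃⁅window⁆ (⟦ φ ⟧ ∘ σ s) ℓ)) (∣⋃⁅⁆∣≡length (S-unique φ s ℓ))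

odd-∣∩S∣≡preimage·V : ∀ φ p s ℓ → odd ∣ p ∩ S φ s ℓ ∣ ≡ preimage ⟦ φ ⟧ p · V (σ s) ℓ
odd-∣∩S∣≡preimage·V φ p s ℓ = begin
  odd ∣ p ∩ S φ s ℓ ∣                                ≡⟨ odd-∣p∩q∣ p _ ⟩
  p · S φ s ℓ                                        ≡⟨ cong (p ·_) (V≡⋃⁅window⁆ (⟦ φ ⟧ ∘ σ s) ℓ) ⟩
  p · ⋃ (map ⁅_⁆ (window (⟦ φ ⟧ ∘ σ s) ℓ))           ≡⟨ ·-⋃⁅⁆-map ⟦ φ ⟧ p (S-unique φ s ℓ) ⟩
  preimage ⟦ φ ⟧ p · ⋃ (map ⁅_⁆ (window (σ s) ℓ))    ≡⟨ cong (preimage ⟦ φ ⟧ p ·_) (V≡⋃⁅window⁆ (σ s) ℓ) ⟨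
  preimage ⟦ φ ⟧ p · V (σ s) ℓ                       ∎
  where open ≡-Reasoning

-- ⁅ 0 ⁆ △ ⁅ k ⁆ as a GF(2)-combination of the index windows V (σ s) ℓ, listed as pairs (s , ℓ).
certificate : Fin 12 → List (Fin 3 × Fin 12)
certificate = Vec.lookup
  ( []
  ∷ ((# 0 , # 1) ∷ (# 1 , # 1) ∷ [])
  ∷ ((# 0 , # 1) ∷ (# 0 , # 2) ∷ (# 1 , # 1) ∷ (# 2 , # 2) ∷ [])
  ∷ ((# 0 , # 0) ∷ (# 0 , # 2) ∷ (# 2 , # 2) ∷ [])
  ∷ ((# 0 , # 0) ∷ (# 0 , # 1) ∷ [])
  ∷ ((# 0 , # 2) ∷ (# 1 , # 1) ∷ [])
  ∷ ((# 0 , # 1) ∷ (# 0 , # 3) ∷ (# 1 , # 1) ∷ (# 2 , # 2) ∷ [])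
  ∷ ((# 0 , # 0) ∷ (# 0 , # 2) ∷ (# 0 , # 3) ∷ (# 0 , # 4) ∷ (# 2 , # 2) ∷ [])
  ∷ ((# 0 , # 8) ∷ (# 0 , # 9) ∷ [])
  ∷ ((# 0 , # 10) ∷ (# 1 , # 9) ∷ [])
  ∷ ((# 0 , # 1) ∷ (# 0 , # 11) ∷ (# 1 , # 1) ∷ (# 2 , # 10) ∷ [])
  ∷ ((# 0 , # 2) ∷ (# 0 , # 11) ∷ (# 2 , # 2) ∷ [])
  ∷ [] )

certificate-sum : ∀ k → ⁅ zero ⁆ △ ⁅ k ⁆ ≡ ⨁ (map (uncurry (V ∘ σ)) (certificate k))
certificate-sum = from-yes (all? λ k → ≡-dec Bool._≟_ (⁅ zero ⁆ △ ⁅ k ⁆) (⨁ (map (uncurry (V ∘ σ)) (certificate k))))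

index-window-parities⇒≡⊎≡∁ : (p q : Subset 12) → (∀ s ℓ → p · V (σ s) ℓ ≡ q · V (σ s) ℓ) →
                             p ≡ q ⊎ p ≡ ∁ q
index-window-parities⇒≡⊎≡∁ p q agree = xor-differences⇒≡⊎≡∁ p q zero λ k → begin
  lookup p zero xor lookup p k                   ≡⟨ ·-⁅⁆△⁅⁆ p zero k ⟨
  p · ⁅ zero ⁆ △ ⁅ k ⁆                           ≡⟨ cong (p ·_) (certificate-sum k) ⟩
  p · ⨁ (map (uncurry (V ∘ σ)) (certificate k))  ≡⟨ ·-⨁-cong p q (uncurry (V ∘ σ)) (uncurry agree) (certificate k) ⟩
  q · ⨁ (map (uncurry (V ∘ σ)) (certificate k))  ≡⟨ cong (q ·_) (certificate-sum k) ⟨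
  q · ⁅ zero ⁆ △ ⁅ k ⁆                           ≡⟨ ·-⁅⁆△⁅⁆ q zero k ⟩
  lookup q zero xor lookup q k                   ∎
  where open ≡-Reasoning

odd-∣∩S∣-determines : (φ : Permutation′ 12) (u v : Vertex) →
                      (∀ s ℓ → odd ∣ proj₁ u ∩ S φ s ℓ ∣ ≡ odd ∣ proj₁ v ∩ S φ s ℓ ∣) →
                      proj₁ u ≡ proj₁ v
odd-∣∩S∣-determines φ u v agree
  with index-window-parities⇒≡⊎≡∁ (preimage ⟦ φ ⟧ (proj₁ u)) (preimage ⟦ φ ⟧ (proj₁ v)) (λ s ℓ →
         trans (sym (odd-∣∩S∣≡preimage·V φ (proj₁ u) s ℓ)) (trans (agree s ℓ) (odd-∣∩S∣≡preimage·V φ (proj₁ v) s ℓ)))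
... | inj₁ u′≡v′  = preimage-injective φ u′≡v′
... | inj₂ u′≡∁v′ = contradiction (preimage-injective φ (trans u′≡∁v′ (sym (preimage-∁ ⟦ φ ⟧ (proj₁ v)))))
                                  (vertex≢∁vertex u v)

FixesS : Permutation′ 12 → Automorphism → Set
FixesS φ Ψ = ∀ (j : Fin 12) →
  Fixes Ψ (V ⟦ φ ⟧ j) × Fixes Ψ (V (φ ∘τ zero) j) × Fixes Ψ (V (φ ∘τ suc zero) j)

fixes-every-vertex : (φ : Permutation′ 12) (Ψ : Automorphism) → FixesS φ Ψ → ∀ v → proj₁ (to Ψ v) ≡ proj₁ v
fixes-every-vertex φ Ψ fixesS v =
  odd-∣∩S∣-determines φ (to Ψ v) v λ s ℓ → odd-∣∩∣-invariant Ψ v (S-vertex φ s ℓ) (fixes s ℓ)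
  where
  fixes : ∀ s ℓ → Fixes Ψ (S φ s ℓ)
  fixes zero             ℓ = proj₁ (fixesS ℓ)
  fixes (suc zero)       ℓ = proj₁ (proj₂ (fixesS ℓ))
  fixes (suc (suc zero)) ℓ = proj₂ (proj₂ (fixesS ℓ))

lemma3p4 : (φ : Permutation′ 12) (Ψ : Automorphism) →
    (∀ (j : Fin 12) →
       Fixes Ψ (V ⟦ φ ⟧ j) × Fixes Ψ (V (φ ∘τ zero) j) × Fixes Ψ (V (φ ∘τ suc zero) j)) →
    ∀ (i j : Fin 12) → Fixes Ψ (V (φ ∘τ i) j)
lemma3p4 φ Ψ fixesS i j v v≡V = trans (fixes-every-vertex φ Ψ fixesS v) v≡V
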